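{- Let $0<\zeta<1/10$ and let $\mathcal{D}=(d_1,\dots,d_n)$ be a degree sequence on $n$ vertices with $n_0=0$, $n_2\le(1-\zeta)n$ and $|Q|\le\zeta/2$. Then: \begin{enumerate} \item[(a)] $\frac12 n\le |E|\le (1+\frac12 Q)n$, and $\sum_{u} d_u^2=(4+2Q)|E|$; \item[(b)] $\frac{\zeta}{4}\le R\le 2\Delta$. \end{enumerate}
   Context: For a degree sequence $\mathcal{D}=(d_1,\dots,d_n)$, $|E|=\frac12\sum_v d_v$, $n_i$ is the number of vertices of degree $i$, $\Delta=\max_v d_v$, and $$Q=\frac{\sum_{u}d_u^2}{2|E|}-2,\qquad R=\frac{\sum_{u}d_u(d_u-2)^2}{2|E|}.$$ -}

module Defs where

open import Data.Nat as ℕ using (ℕ; zero; suc; _⊔_)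
open import Data.Integer as ℤ using (ℤ; +_)
open import Data.Rational as ℚ using (ℚ)
open import Data.Vec using (Vec; []; _∷_; map; sum; count; foldr′)
open import Relation.Binary.PropositionalEquality using (_≡_)

DegSeq : ℕ → Set
DegSeq n = Vec ℕ n

-- a / b as a rational; convention a / 0 = 0 (never used under the hypotheses,
-- where the denominator 2|E| = Σ d_u is positive)
ratio : ℤ → ℕ → ℚ
ratio a zero    = ℚ.0ℚ
ratio a (suc b) = a ℚ./ suc b

sumℤ : ∀ {n} → Vec ℤ n → ℤ
sumℤ = foldr′ ℤ._+_ (+ 0)

twoE : ∀ {n} → DegSeq n → ℕ
twoE d = sum d

numE : ∀ {n} → DegSeq n → ℚ
numE d = ratio (+ twoE d) 2

nDeg : ∀ {n} → ℕ → DegSeq n → ℕ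
nDeg i d = count (ℕ._≟ i) d

maxDeg : ∀ {n} → DegSeq n → ℕ
maxDeg d = foldr′ _⊔_ 0 d

sumSq : ∀ {n} → DegSeq n → ℕ
sumSq d = sum (map (λ x → x ℕ.* x) d)

Qof : ∀ {n} → DegSeq n → ℚ
Qof d = ratio (+ sumSq d) (twoE d) ℚ.- ℚ.1ℚ ℚ.- ℚ.1ℚ

Rof : ∀ {n} → DegSeq n → ℚ
Rof d = ratio (sumℤ (map (λ x → (+ x) ℤ.* ((+ x ℤ.- + 2) ℤ.* (+ x ℤ.- + 2))) d)) (twoE d)

ℕ→ℚ : ℕ → ℚ
ℕ→ℚ k = + k ℚ./ 1

-- Write S = Σ d_u = 2|E|, T = Σ d_u² and U = Σ d_u (d_u − 2)², so that Q + 2 = T / S and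
-- R = U / S. As no degree is 0, n ≤ S, and Cauchy–Schwarz S² ≤ n T gives S ≤ (Q + 2) n; this
-- is (a). Every vertex of degree other than 2 contributes at least 1 to U, so U ≥ n − n₂ ≥ ζ n,
-- while S ≤ (Q + 2) n ≤ 4 n; hence R ≥ ζ / 4. Finally (x − 2)² lies below its chord on [1, Δ],
-- so x (x − 2)² ≤ (Δ − 2)(x² − x) + x, and summing, U ≤ (Δ − 2)(T − S) + S ≤ (2Δ − 3) S
-- because T ≤ 3 S when Q ≤ 1.

module Submission where

open import Defs

module NatInequalities where
  open import Data.Nat
  open import Data.Nat.Properties
  open import Data.Nat.Tactic.RingSolver using (solve-∀)
  open import Data.Vec using ([]; _∷_; map; sum)
  open import Data.Vec.Relation.Unary.All as All using (All; []; _∷_)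
  open import Data.Sum using (inj₁; inj₂)
  open import Data.Product using (_,_)
  open import Relation.Binary.PropositionalEquality

  ≤-by : ∀ {m n} o → m + o ≡ n → m ≤ n
  ≤-by {m} o refl = m≤m+n m o

  2*[m*n]≤m*m+n*n : ∀ m n → 2 * (m * n) ≤ m * m + n * n
  2*[m*n]≤m*m+n*n m n with ≤-total m n
  ... | inj₁ m≤n with m≤n⇒∃[o]m+o≡n m≤n
  ...   | o , refl = ≤-by (o * o) (am-gm m o)
    where
    am-gm : ∀ m o → 2 * (m * (m + o)) + o * o ≡ m * m + (m + o) * (m + o)
    am-gm = solve-∀
  2*[m*n]≤m*m+n*n m n | inj₂ n≤m with m≤n⇒∃[o]m+o≡n n≤m
  ...   | o , refl = ≤-by (o * o) (am-gm n o)
    where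
    am-gm : ∀ n o → 2 * ((n + o) * n) + o * o ≡ (n + o) * (n + o) + n * n
    am-gm = solve-∀

  2*twoE*x≤sumSq+n*x*x : ∀ {n} (d : DegSeq n) x → 2 * (twoE d * x) ≤ sumSq d + n * (x * x)
  2*twoE*x≤sumSq+n*x*x [] x = z≤n
  2*twoE*x≤sumSq+n*x*x {suc n} (y ∷ d) x = begin
    2 * ((y + twoE d) * x)                    ≡⟨ split y (twoE d) x ⟩
    2 * (y * x) + 2 * (twoE d * x)            ≤⟨ +-mono-≤ (2*[m*n]≤m*m+n*n y x) (2*twoE*x≤sumSq+n*x*x d x) ⟩
    (y * y + x * x) + (sumSq d + n * (x * x)) ≡⟨ regroup y x (sumSq d) n ⟩
    (y * y + sumSq d) + (x * x + n * (x * x)) ∎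
    where
    open ≤-Reasoning
    split : ∀ y S x → 2 * ((y + S) * x) ≡ 2 * (y * x) + 2 * (S * x)
    split = solve-∀
    regroup : ∀ y x T n → (y * y + x * x) + (T + n * (x * x)) ≡ (y * y + T) + (x * x + n * (x * x))
    regroup = solve-∀

  twoE*twoE≤n*sumSq : ∀ {n} (d : DegSeq n) → twoE d * twoE d ≤ n * sumSq d
  twoE*twoE≤n*sumSq [] = z≤n
  twoE*twoE≤n*sumSq {suc n} (y ∷ d) = begin
    (y + twoE d) * (y + twoE d)                   ≡⟨ expand y (twoE d) ⟩
    y * y + 2 * (twoE d * y) + twoE d * twoE d
      ≤⟨ +-mono-≤ (+-monoʳ-≤ (y * y) (2*twoE*x≤sumSq+n*x*x d y)) (twoE*twoE≤n*sumSq d) ⟩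
    y * y + (sumSq d + n * (y * y)) + n * sumSq d ≡⟨ regroup y (sumSq d) n ⟩
    (y * y + sumSq d) + n * (y * y + sumSq d)     ∎
    where
    open ≤-Reasoning
    expand : ∀ y S → (y + S) * (y + S) ≡ y * y + 2 * (S * y) + S * S
    expand = solve-∀
    regroup : ∀ y T n → y * y + (T + n * (y * y)) + n * T ≡ (y * y + T) + n * (y * y + T)
    regroup = solve-∀

  n≤twoE : ∀ {n} (d : DegSeq n) → nDeg 0 d ≡ 0 → n ≤ twoE d
  n≤twoE [] _ = z≤n
  n≤twoE (zero ∷ d) ()
  n≤twoE (suc k ∷ d) n₀≡0 = s≤s (≤-trans (n≤twoE d n₀≡0) (m≤n+m (twoE d) k))

  -- x (x − 2)², by cases: with truncated subtraction the value at x = 1 would come out as 0.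
  Rsummand : ℕ → ℕ
  Rsummand zero = 0
  Rsummand (suc zero) = 1
  Rsummand (suc (suc k)) = (2 + k) * (k * k)

  ΣRsummand : ∀ {n} → DegSeq n → ℕ
  ΣRsummand d = sum (map Rsummand d)

  suc-≤-+suc : ∀ {n} a b c → n ≤ a + c → suc n ≤ a + (suc b + c)
  suc-≤-+suc {n} a b c n≤a+c = begin
    suc n             ≤⟨ s≤s n≤a+c ⟩
    suc (a + c)       ≤⟨ s≤s (+-monoʳ-≤ a (m≤n+m c b)) ⟩
    suc (a + (b + c)) ≡⟨ +-suc a (b + c) ⟨
    a + (suc b + c)   ∎
    where open ≤-Reasoning

  n≤nDeg2+ΣRsummand : ∀ {n} (d : DegSeq n) → nDeg 0 d ≡ 0 → n ≤ nDeg 2 d + ΣRsummand d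
  n≤nDeg2+ΣRsummand [] _ = z≤n
  n≤nDeg2+ΣRsummand (zero ∷ d) ()
  n≤nDeg2+ΣRsummand (suc zero ∷ d) n₀≡0 =
    suc-≤-+suc (nDeg 2 d) 0 (ΣRsummand d) (n≤nDeg2+ΣRsummand d n₀≡0)
  n≤nDeg2+ΣRsummand (suc (suc zero) ∷ d) n₀≡0 = s≤s (n≤nDeg2+ΣRsummand d n₀≡0)
  n≤nDeg2+ΣRsummand (suc (suc (suc k)) ∷ d) n₀≡0 =
    suc-≤-+suc (nDeg 2 d) _ (ΣRsummand d) (n≤nDeg2+ΣRsummand d n₀≡0)

  -- (x − 2)² ≤ D (x − 1) + 1 on 1 ≤ x ≤ D + 2 (a parabola below its chord), multiplied by x
  -- and with the negative terms moved across.
  Rsummand≤chord : ∀ D x → x ≤ 2 + D → Rsummand x + 2 * D * x ≤ D * (x * x) + (D + 1) * x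
  Rsummand≤chord D zero _ = ≤-reflexive (at0 D)
    where
    at0 : ∀ D → 2 * D * 0 ≡ D * 0 + (D + 1) * 0
    at0 = solve-∀
  Rsummand≤chord D (suc zero) _ = ≤-reflexive (at1 D)
    where
    at1 : ∀ D → 1 + 2 * D * 1 ≡ D * 1 + (D + 1) * 1
    at1 = solve-∀
  Rsummand≤chord D (suc (suc k)) (s≤s (s≤s k≤D)) with m≤n⇒∃[o]m+o≡n k≤D
  ... | m , refl = ≤-by ((2 + k) * (m * k + (k + m) + 1)) (gap k m)
    where
    gap : ∀ k m → (2 + k) * (k * k) + 2 * (k + m) * (2 + k) + (2 + k) * (m * k + (k + m) + 1)
                ≡ (k + m) * ((2 + k) * (2 + k)) + ((k + m) + 1) * (2 + k)
    gap = solve-∀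

  ΣRsummand≤chord : ∀ {n} D (d : DegSeq n) → All (_≤ 2 + D) d →
                    ΣRsummand d + 2 * D * twoE d ≤ D * sumSq d + (D + 1) * twoE d
  ΣRsummand≤chord D [] [] = ≤-reflexive (empty D)
    where
    empty : ∀ D → 0 + 2 * D * 0 ≡ D * 0 + (D + 1) * 0
    empty = solve-∀
  ΣRsummand≤chord D (x ∷ d) (x≤2+D ∷ d≤2+D) = begin
    (Rsummand x + ΣRsummand d) + 2 * D * (x + twoE d)
      ≡⟨ split (Rsummand x) x (ΣRsummand d) D (twoE d) ⟩
    (Rsummand x + 2 * D * x) + (ΣRsummand d + 2 * D * twoE d)
      ≤⟨ +-mono-≤ (Rsummand≤chord D x x≤2+D) (ΣRsummand≤chord D d d≤2+D) ⟩
    (D * (x * x) + (D + 1) * x) + (D * sumSq d + (D + 1) * twoE d)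
      ≡⟨ merge x D (sumSq d) (twoE d) ⟩
    D * (x * x + sumSq d) + (D + 1) * (x + twoE d) ∎
    where
    open ≤-Reasoning
    split : ∀ a x U D S → (a + U) + 2 * D * (x + S) ≡ (a + 2 * D * x) + (U + 2 * D * S)
    split = solve-∀
    merge : ∀ x D T S → (D * (x * x) + (D + 1) * x) + (D * T + (D + 1) * S) ≡ D * (x * x + T) + (D + 1) * (x + S)
    merge = solve-∀

  all≤maxDeg : ∀ {n} (d : DegSeq n) → All (_≤ maxDeg d) d
  all≤maxDeg [] = []
  all≤maxDeg (x ∷ d) = m≤m⊔n x (maxDeg d) ∷ All.map (m≤n⇒m≤o⊔n x) (all≤maxDeg d)

  twoE>0⇒maxDeg>0 : ∀ {n} (d : DegSeq n) → 0 < twoE d → 0 < maxDeg d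
  twoE>0⇒maxDeg>0 [] ()
  twoE>0⇒maxDeg>0 (zero ∷ d) S>0 = twoE>0⇒maxDeg>0 d S>0
  twoE>0⇒maxDeg>0 (suc x ∷ d) _ = ≤-trans (s≤s z≤n) (m≤m⊔n (suc x) (maxDeg d))

  2*[m∸2]+1≤2*m : ∀ m → 0 < m → 2 * (m ∸ 2) + 1 ≤ 2 * m
  2*[m∸2]+1≤2*m (suc zero) _ = s≤s z≤n
  2*[m∸2]+1≤2*m (suc (suc k)) _ = ≤-by 3 (gap k)
    where
    gap : ∀ k → 2 * k + 1 + 3 ≡ 2 * (2 + k)
    gap = solve-∀

  ΣRsummand≤[2D+1]*twoE : ∀ {n} D (d : DegSeq n) → All (_≤ 2 + D) d → sumSq d ≤ 3 * twoE d →
                          ΣRsummand d ≤ (2 * D + 1) * twoE d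
  ΣRsummand≤[2D+1]*twoE D d d≤2+D T≤3S = +-cancelʳ-≤ (2 * D * S) (ΣRsummand d) ((2 * D + 1) * S) (begin
    ΣRsummand d + 2 * D * S     ≤⟨ ΣRsummand≤chord D d d≤2+D ⟩
    D * sumSq d + (D + 1) * S   ≤⟨ +-monoˡ-≤ ((D + 1) * S) (*-monoʳ-≤ D T≤3S) ⟩
    D * (3 * S) + (D + 1) * S   ≡⟨ regroup D S ⟩
    (2 * D + 1) * S + 2 * D * S ∎)
    where
    open ≤-Reasoning
    S = twoE d
    regroup : ∀ D S → D * (3 * S) + (D + 1) * S ≡ (2 * D + 1) * S + 2 * D * S
    regroup = solve-∀

  ΣRsummand≤2*maxDeg*twoE : ∀ {n} (d : DegSeq n) → 0 < twoE d → sumSq d ≤ 3 * twoE d →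
                            ΣRsummand d ≤ 2 * maxDeg d * twoE d
  ΣRsummand≤2*maxDeg*twoE d S>0 T≤3S = begin
    ΣRsummand d               ≤⟨ ΣRsummand≤[2D+1]*twoE D d d≤2+D T≤3S ⟩
    (2 * D + 1) * twoE d      ≤⟨ *-monoˡ-≤ (twoE d) (2*[m∸2]+1≤2*m Δ (twoE>0⇒maxDeg>0 d S>0)) ⟩
    2 * Δ * twoE d            ∎
    where
    open ≤-Reasoning
    Δ = maxDeg d
    D = Δ ∸ 2
    d≤2+D : All (_≤ 2 + D) d
    d≤2+D = All.map (λ x≤Δ → ≤-trans x≤Δ (m≤n+m∸n Δ 2)) (all≤maxDeg d)

open NatInequalities

open import Data.Nat as ℕ using (ℕ; zero; suc)
import Data.Nat.Properties as ℕP
open import Data.Integer as ℤ using (+_; -[1+_])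
import Data.Integer.Properties as ℤP
open import Data.Rational as ℚ using (ℚ; mkℚ; toℚᵘ; _<_; _≤_; _+_; _*_; _-_; ∣_∣; 0ℚ; 1ℚ; _/_)
open import Data.Rational.Properties
open import Data.Rational.Unnormalised as ℚᵘ using (mkℚᵘ; *≡*)
import Data.Rational.Unnormalised.Properties as ℚᵘP
open import Data.Rational.Solver using (module +-*-Solver)
open import Data.Nat.Divisibility using (_∣_)
open import Data.Nat.Coprimality using (1-coprimeTo) renaming (sym to coprime-sym)
open import Data.Vec using ([]; _∷_; map)
open import Data.Product using (_×_; _,_)
open import Relation.Binary.PropositionalEquality
open +-*-Solver

ℕ→ℚ≡mkℚ : ∀ k → ℕ→ℚ k ≡ mkℚ (+ k) 0 (coprime-sym (1-coprimeTo k))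
ℕ→ℚ≡mkℚ k = normalize-coprime (coprime-sym (1-coprimeTo k))

ℕ→ℚ-suc : ∀ k → ℕ→ℚ (suc k) ≡ 1ℚ + ℕ→ℚ k
ℕ→ℚ-suc k = sym (begin
  1ℚ + ℕ→ℚ k                  ≡⟨ cong (_+_ 1ℚ) (ℕ→ℚ≡mkℚ k) ⟩
  (+ 1 ℤ.+ + k ℤ.* + 1) / 1   ≡⟨ /-cong (cong (ℤ._+_ (+ 1)) (ℤP.*-identityʳ (+ k))) refl ⟩
  ℕ→ℚ (suc k)                 ∎)
  where open ≡-Reasoning

ℕ→ℚ-homo-+ : ∀ a b → ℕ→ℚ (a ℕ.+ b) ≡ ℕ→ℚ a + ℕ→ℚ b
ℕ→ℚ-homo-+ zero b = sym (+-identityˡ (ℕ→ℚ b))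
ℕ→ℚ-homo-+ (suc a) b = begin
  ℕ→ℚ (suc (a ℕ.+ b))  ≡⟨ ℕ→ℚ-suc (a ℕ.+ b) ⟩
  1ℚ + ℕ→ℚ (a ℕ.+ b)   ≡⟨ cong (_+_ 1ℚ) (ℕ→ℚ-homo-+ a b) ⟩
  1ℚ + (ℕ→ℚ a + ℕ→ℚ b) ≡⟨ +-assoc 1ℚ (ℕ→ℚ a) (ℕ→ℚ b) ⟨
  1ℚ + ℕ→ℚ a + ℕ→ℚ b   ≡⟨ cong (λ x → x + ℕ→ℚ b) (ℕ→ℚ-suc a) ⟨
  ℕ→ℚ (suc a) + ℕ→ℚ b  ∎
  where open ≡-Reasoning

ℕ→ℚ-homo-* : ∀ a b → ℕ→ℚ (a ℕ.* b) ≡ ℕ→ℚ a * ℕ→ℚ b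
ℕ→ℚ-homo-* zero b = sym (*-zeroˡ (ℕ→ℚ b))
ℕ→ℚ-homo-* (suc a) b = begin
  ℕ→ℚ (b ℕ.+ a ℕ.* b)    ≡⟨ ℕ→ℚ-homo-+ b (a ℕ.* b) ⟩
  ℕ→ℚ b + ℕ→ℚ (a ℕ.* b)  ≡⟨ cong (_+_ (ℕ→ℚ b)) (ℕ→ℚ-homo-* a b) ⟩
  ℕ→ℚ b + ℕ→ℚ a * ℕ→ℚ b  ≡⟨ solve 2 (λ x y → y :+ x :* y := (con 1ℚ :+ x) :* y) refl (ℕ→ℚ a) (ℕ→ℚ b) ⟩
  (1ℚ + ℕ→ℚ a) * ℕ→ℚ b   ≡⟨ cong (λ x → x * ℕ→ℚ b) (ℕ→ℚ-suc a) ⟨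
  ℕ→ℚ (suc a) * ℕ→ℚ b    ∎
  where open ≡-Reasoning

ℕ→ℚ-mono-≤ : ∀ {a b} → a ℕ.≤ b → ℕ→ℚ a ≤ ℕ→ℚ b
ℕ→ℚ-mono-≤ {a} {b} a≤b rewrite ℕ→ℚ≡mkℚ a | ℕ→ℚ≡mkℚ b =
  ℚ.*≤* (ℤP.*-monoʳ-≤-nonNeg (+ 1) (ℤ.+≤+ a≤b))

ℕ→ℚ-cancel-≤ : ∀ {a b} → ℕ→ℚ a ≤ ℕ→ℚ b → a ℕ.≤ b
ℕ→ℚ-cancel-≤ {a} {b} a≤b rewrite ℕ→ℚ≡mkℚ a | ℕ→ℚ≡mkℚ b with a≤b
... | ℚ.*≤* a*1≤b*1 =
  ℤP.drop‿+≤+ (subst₂ ℤ._≤_ (ℤP.*-identityʳ (+ a)) (ℤP.*-identityʳ (+ b)) a*1≤b*1)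

ℕ→ℚ-nonNeg : ∀ k → ℚ.NonNegative (ℕ→ℚ k)
ℕ→ℚ-nonNeg k = normalize-nonNeg k 1

ℕ→ℚ-pos : ∀ k .{{_ : ℕ.NonZero k}} → ℚ.Positive (ℕ→ℚ k)
ℕ→ℚ-pos k = normalize-pos k 1

-- ratio a (suc m) is definitionally fromℚᵘ (mkℚᵘ a m), which toℚᵘ-fromℚᵘ undoes.
ratio*denominator : ∀ a m .{{_ : ℕ.NonZero m}} → ratio (+ a) m * ℕ→ℚ m ≡ ℕ→ℚ a
ratio*denominator a (suc m) = toℚᵘ-injective (begin-equality
  toℚᵘ (ratio (+ a) (suc m) * ℕ→ℚ (suc m))
    ≃⟨ toℚᵘ-homo-* (ratio (+ a) (suc m)) (ℕ→ℚ (suc m)) ⟩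
  toℚᵘ (ratio (+ a) (suc m)) ℚᵘ.* toℚᵘ (ℕ→ℚ (suc m))
    ≃⟨ ℚᵘP.*-cong (toℚᵘ-fromℚᵘ (mkℚᵘ (+ a) m)) (toℚᵘ-fromℚᵘ (mkℚᵘ (+ suc m) 0)) ⟩
  mkℚᵘ (+ a) m ℚᵘ.* mkℚᵘ (+ suc m) 0
    ≃⟨ *≡* (trans (ℤP.*-identityʳ _) (cong (λ k → + a ℤ.* + suc k) (sym (ℕP.*-identityʳ m)))) ⟩
  mkℚᵘ (+ a) 0
    ≃⟨ toℚᵘ-fromℚᵘ (mkℚᵘ (+ a) 0) ⟨
  toℚᵘ (ℕ→ℚ a) ∎)
  where open ℚᵘP.≤-Reasoning

≤-ratio : ∀ {p} a m .{{_ : ℕ.NonZero m}} → p * ℕ→ℚ m ≤ ℕ→ℚ a → p ≤ ratio (+ a) m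
≤-ratio a m pm≤a =
  *-cancelʳ-≤-pos (ℕ→ℚ m) {{ℕ→ℚ-pos m}} (subst (_ ≤_) (sym (ratio*denominator a m)) pm≤a)

ratio-≤ : ∀ {p} a m .{{_ : ℕ.NonZero m}} → ℕ→ℚ a ≤ p * ℕ→ℚ m → ratio (+ a) m ≤ p
ratio-≤ a m a≤pm =
  *-cancelʳ-≤-pos (ℕ→ℚ m) {{ℕ→ℚ-pos m}} (subst (_≤ _) (sym (ratio*denominator a m)) a≤pm)

p≤∣p∣ : ∀ p → p ≤ ∣ p ∣
p≤∣p∣ (mkℚ (+ _) _ _) = ≤-refl
p≤∣p∣ (mkℚ -[1+ _ ] _ _) = ℚ.*≤* ℤ.-≤+

½ : ℚ
½ = + 1 / 2

Rsummand-ℤ : ∀ x → + x ℤ.* ((+ x ℤ.- + 2) ℤ.* (+ x ℤ.- + 2)) ≡ + Rsummand x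
Rsummand-ℤ zero = refl
Rsummand-ℤ (suc zero) = refl
Rsummand-ℤ (suc (suc k)) = begin
  + (2 ℕ.+ k) ℤ.* (+ k ℤ.* + k) ≡⟨ cong (ℤ._*_ (+ (2 ℕ.+ k))) (ℤP.pos-* k k) ⟨
  + (2 ℕ.+ k) ℤ.* + (k ℕ.* k)   ≡⟨ ℤP.pos-* (2 ℕ.+ k) (k ℕ.* k) ⟨
  + Rsummand (suc (suc k))      ∎
  where open ≡-Reasoning

Rof≡ratio-ΣRsummand : ∀ {n} (d : DegSeq n) → Rof d ≡ ratio (+ ΣRsummand d) (twoE d)
Rof≡ratio-ΣRsummand d = cong (λ a → ratio a (twoE d)) (numerator d)
  where
  numerator : ∀ {n} (d : DegSeq n) →
              sumℤ (map (λ x → + x ℤ.* ((+ x ℤ.- + 2) ℤ.* (+ x ℤ.- + 2))) d) ≡ + ΣRsummand d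
  numerator [] = refl
  numerator (x ∷ d) =
    trans (cong₂ ℤ._+_ (Rsummand-ℤ x) (numerator d)) (sym (ℤP.pos-+ (Rsummand x) (ΣRsummand d)))

numE≡½*twoE : ∀ {n} (d : DegSeq n) → numE d ≡ ½ * ℕ→ℚ (twoE d)
numE≡½*twoE d = begin
  numE d                   ≡⟨ solve 1 (λ e → e := con ½ :* (e :* con (ℕ→ℚ 2))) refl (numE d) ⟩
  ½ * (numE d * ℕ→ℚ 2)     ≡⟨ cong (_*_ ½) (ratio*denominator (twoE d) 2) ⟩
  ½ * ℕ→ℚ (twoE d)         ∎
  where open ≡-Reasoning

sumSq≡[Qof+2]*twoE : ∀ {n} (d : DegSeq n) .{{_ : ℕ.NonZero (twoE d)}} →
                     ℕ→ℚ (sumSq d) ≡ (Qof d + 1ℚ + 1ℚ) * ℕ→ℚ (twoE d)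
sumSq≡[Qof+2]*twoE d = begin
  ℕ→ℚ (sumSq d)                    ≡⟨ ratio*denominator (sumSq d) (twoE d) ⟨
  q * ℕ→ℚ (twoE d)                 ≡⟨ cong (_* ℕ→ℚ (twoE d)) (q≡q-1-1+1+1 q) ⟩
  (Qof d + 1ℚ + 1ℚ) * ℕ→ℚ (twoE d) ∎
  where
  open ≡-Reasoning
  q = ratio (+ sumSq d) (twoE d)
  q≡q-1-1+1+1 : ∀ q → q ≡ q - 1ℚ - 1ℚ + 1ℚ + 1ℚ
  q≡q-1-1+1+1 = solve 1 (λ q → q := q :- con 1ℚ :- con 1ℚ :+ con 1ℚ :+ con 1ℚ) refl

twoE≤[Qof+2]*n : ∀ {n} (d : DegSeq n) .{{_ : ℕ.NonZero (twoE d)}} →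
                 ℕ→ℚ (twoE d) ≤ (Qof d + 1ℚ + 1ℚ) * ℕ→ℚ n
twoE≤[Qof+2]*n {n} d = *-cancelʳ-≤-pos s {{ℕ→ℚ-pos (twoE d)}} (begin
  s * s                   ≡⟨ ℕ→ℚ-homo-* (twoE d) (twoE d) ⟨
  ℕ→ℚ (twoE d ℕ.* twoE d) ≤⟨ ℕ→ℚ-mono-≤ (twoE*twoE≤n*sumSq d) ⟩
  ℕ→ℚ (n ℕ.* sumSq d)     ≡⟨ ℕ→ℚ-homo-* n (sumSq d) ⟩
  ℕ→ℚ n * ℕ→ℚ (sumSq d)   ≡⟨ cong (_*_ (ℕ→ℚ n)) (sumSq≡[Qof+2]*twoE d) ⟩
  ℕ→ℚ n * (q * s)         ≡⟨ solve 3 (λ n q s → n :* (q :* s) := q :* n :* s) refl (ℕ→ℚ n) q s ⟩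
  q * ℕ→ℚ n * s           ∎)
  where
  open ≤-Reasoning
  s = ℕ→ℚ (twoE d)
  q = Qof d + 1ℚ + 1ℚ

sumSq≤3*twoE : ∀ {n} (d : DegSeq n) .{{_ : ℕ.NonZero (twoE d)}} → Qof d ≤ 1ℚ →
               sumSq d ℕ.≤ 3 ℕ.* twoE d
sumSq≤3*twoE d Q≤1 = ℕ→ℚ-cancel-≤ (begin
  ℕ→ℚ (sumSq d)                    ≡⟨ sumSq≡[Qof+2]*twoE d ⟩
  (Qof d + 1ℚ + 1ℚ) * ℕ→ℚ (twoE d) ≤⟨ *-monoʳ-≤-nonNeg (ℕ→ℚ (twoE d)) {{ℕ→ℚ-nonNeg (twoE d)}} Q+2≤3 ⟩
  ℕ→ℚ 3 * ℕ→ℚ (twoE d)             ≡⟨ ℕ→ℚ-homo-* 3 (twoE d) ⟨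
  ℕ→ℚ (3 ℕ.* twoE d)               ∎)
  where
  open ≤-Reasoning
  Q+2≤3 : Qof d + 1ℚ + 1ℚ ≤ ℕ→ℚ 3
  Q+2≤3 = +-monoˡ-≤ 1ℚ (+-monoˡ-≤ 1ℚ Q≤1)

ζn≤ΣRsummand : ∀ ζ {n} (d : DegSeq n) → nDeg 0 d ≡ 0 → ℕ→ℚ (nDeg 2 d) ≤ (1ℚ - ζ) * ℕ→ℚ n →
               ζ * ℕ→ℚ n ≤ ℕ→ℚ (ΣRsummand d)
ζn≤ΣRsummand ζ {n} d n₀≡0 n₂≤[1-ζ]n = begin
  ζ * ℕ→ℚ n           ≡⟨ solve 2 (λ z n → z :* n := n :- (con 1ℚ :- z) :* n) refl ζ (ℕ→ℚ n) ⟩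
  ℕ→ℚ n - A           ≤⟨ +-monoˡ-≤ (ℚ.- A) (≤-trans n≤n₂+U (+-monoˡ-≤ U n₂≤[1-ζ]n)) ⟩
  (A + U) - A         ≡⟨ solve 2 (λ A U → (A :+ U) :- A := U) refl A U ⟩
  U                   ∎
  where
  open ≤-Reasoning
  A = (1ℚ - ζ) * ℕ→ℚ n
  U = ℕ→ℚ (ΣRsummand d)
  n≤n₂+U : ℕ→ℚ n ≤ ℕ→ℚ (nDeg 2 d) + U
  n≤n₂+U = subst (ℕ→ℚ n ≤_) (ℕ→ℚ-homo-+ (nDeg 2 d) (ΣRsummand d))
                 (ℕ→ℚ-mono-≤ (n≤nDeg2+ΣRsummand d n₀≡0))

½n≤numE : ∀ {n} (d : DegSeq n) → nDeg 0 d ≡ 0 → ½ * ℕ→ℚ n ≤ numE d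
½n≤numE {n} d n₀≡0 = begin
  ½ * ℕ→ℚ n        ≤⟨ *-monoˡ-≤-nonNeg ½ (ℕ→ℚ-mono-≤ (n≤twoE d n₀≡0)) ⟩
  ½ * ℕ→ℚ (twoE d) ≡⟨ numE≡½*twoE d ⟨
  numE d           ∎
  where open ≤-Reasoning

numE≤[1+½Q]n : ∀ {n} (d : DegSeq n) .{{_ : ℕ.NonZero (twoE d)}} →
               numE d ≤ (1ℚ + ½ * Qof d) * ℕ→ℚ n
numE≤[1+½Q]n {n} d = begin
  numE d                             ≡⟨ numE≡½*twoE d ⟩
  ½ * ℕ→ℚ (twoE d)                   ≤⟨ *-monoˡ-≤-nonNeg ½ (twoE≤[Qof+2]*n d) ⟩
  ½ * ((Qof d + 1ℚ + 1ℚ) * ℕ→ℚ n)    ≡⟨ rearrange (Qof d) (ℕ→ℚ n) ⟩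
  (1ℚ + ½ * Qof d) * ℕ→ℚ n           ∎
  where
  open ≤-Reasoning
  rearrange : ∀ Q n → ½ * ((Q + 1ℚ + 1ℚ) * n) ≡ (1ℚ + ½ * Q) * n
  rearrange = solve 2 (λ Q n → con ½ :* ((Q :+ con 1ℚ :+ con 1ℚ) :* n) := (con 1ℚ :+ con ½ :* Q) :* n) refl

sumSq≡[4+2Q]numE : ∀ {n} (d : DegSeq n) .{{_ : ℕ.NonZero (twoE d)}} →
                   ℕ→ℚ (sumSq d) ≡ (ℕ→ℚ 4 + ℕ→ℚ 2 * Qof d) * numE d
sumSq≡[4+2Q]numE d = begin
  ℕ→ℚ (sumSq d)                           ≡⟨ sumSq≡[Qof+2]*twoE d ⟩
  (Qof d + 1ℚ + 1ℚ) * ℕ→ℚ (twoE d)        ≡⟨ cong (_*_ (Qof d + 1ℚ + 1ℚ)) (ratio*denominator (twoE d) 2) ⟨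
  (Qof d + 1ℚ + 1ℚ) * (numE d * ℕ→ℚ 2)    ≡⟨ rearrange (Qof d) (numE d) ⟩
  (ℕ→ℚ 4 + ℕ→ℚ 2 * Qof d) * numE d        ∎
  where
  open ≡-Reasoning
  rearrange : ∀ Q e → (Q + 1ℚ + 1ℚ) * (e * ℕ→ℚ 2) ≡ (ℕ→ℚ 4 + ℕ→ℚ 2 * Q) * e
  rearrange = solve 2 (λ Q e → (Q :+ con 1ℚ :+ con 1ℚ) :* (e :* con (ℕ→ℚ 2))
                            := (con (ℕ→ℚ 4) :+ con (ℕ→ℚ 2) :* Q) :* e) refl

¼ζ≤Rof : ∀ ζ {n} (d : DegSeq n) .{{_ : ℕ.NonZero (twoE d)}} → 0ℚ ≤ ζ →
         nDeg 0 d ≡ 0 → ℕ→ℚ (nDeg 2 d) ≤ (1ℚ - ζ) * ℕ→ℚ n → Qof d ≤ ℕ→ℚ 2 →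
         ζ * (+ 1 / 4) ≤ Rof d
¼ζ≤Rof ζ {n} d 0≤ζ n₀≡0 n₂≤[1-ζ]n Q≤2 rewrite Rof≡ratio-ΣRsummand d =
  ≤-ratio (ΣRsummand d) (twoE d) (begin
    ζ * ¼ * ℕ→ℚ (twoE d)                ≤⟨ *-monoˡ-≤-nonNeg (ζ * ¼) {{ζ/4≥0}} (twoE≤[Qof+2]*n d) ⟩
    ζ * ¼ * ((Qof d + 1ℚ + 1ℚ) * ℕ→ℚ n) ≤⟨ *-monoˡ-≤-nonNeg (ζ * ¼) {{ζ/4≥0}} [Q+2]n≤4n ⟩
    ζ * ¼ * (ℕ→ℚ 4 * ℕ→ℚ n)             ≡⟨ cancel ζ (ℕ→ℚ n) ⟩
    ζ * ℕ→ℚ n                           ≤⟨ ζn≤ΣRsummand ζ d n₀≡0 n₂≤[1-ζ]n ⟩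
    ℕ→ℚ (ΣRsummand d)                   ∎)
  where
  open ≤-Reasoning
  ¼ = + 1 / 4
  ζ/4≥0 : ℚ.NonNegative (ζ * ¼)
  ζ/4≥0 = ℚ.nonNegative (*-monoʳ-≤-nonNeg ¼ 0≤ζ)
  [Q+2]n≤4n : (Qof d + 1ℚ + 1ℚ) * ℕ→ℚ n ≤ ℕ→ℚ 4 * ℕ→ℚ n
  [Q+2]n≤4n = *-monoʳ-≤-nonNeg (ℕ→ℚ n) {{ℕ→ℚ-nonNeg n}} (+-monoˡ-≤ 1ℚ (+-monoˡ-≤ 1ℚ Q≤2))
  cancel : ∀ z n → z * ¼ * (ℕ→ℚ 4 * n) ≡ z * n
  cancel = solve 2 (λ z n → z :* con ¼ :* (con (ℕ→ℚ 4) :* n) := z :* n) refl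

Rof≤2Δ : ∀ {n} (d : DegSeq n) .{{_ : ℕ.NonZero (twoE d)}} → Qof d ≤ 1ℚ →
         Rof d ≤ ℕ→ℚ 2 * ℕ→ℚ (maxDeg d)
Rof≤2Δ d Q≤1 rewrite Rof≡ratio-ΣRsummand d = ratio-≤ (ΣRsummand d) (twoE d) (begin
  ℕ→ℚ (ΣRsummand d)                      ≤⟨ ℕ→ℚ-mono-≤ U≤2ΔS ⟩
  ℕ→ℚ (2 ℕ.* Δ ℕ.* twoE d)               ≡⟨ ℕ→ℚ-homo-* (2 ℕ.* Δ) (twoE d) ⟩
  ℕ→ℚ (2 ℕ.* Δ) * ℕ→ℚ (twoE d)           ≡⟨ cong (_* ℕ→ℚ (twoE d)) (ℕ→ℚ-homo-* 2 Δ) ⟩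
  ℕ→ℚ 2 * ℕ→ℚ Δ * ℕ→ℚ (twoE d)           ∎)
  where
  open ≤-Reasoning
  Δ = maxDeg d
  U≤2ΔS : ΣRsummand d ℕ.≤ 2 ℕ.* Δ ℕ.* twoE d
  U≤2ΔS = ΣRsummand≤2*maxDeg*twoE d (ℕ.>-nonZero⁻¹ (twoE d)) (sumSq≤3*twoE d Q≤1)

lemma4 : (ζ : ℚ) → 0ℚ < ζ → ζ < (+ 1 / 10) →
         (n : ℕ) → 0 ℕ.< n → (d : DegSeq n) →
         2 ∣ twoE d →
         nDeg 0 d ≡ 0 →
         ℕ→ℚ (nDeg 2 d) ≤ (1ℚ - ζ) * ℕ→ℚ n →
         ∣ Qof d ∣ ≤ ζ * (+ 1 / 2) →
         ((+ 1 / 2) * ℕ→ℚ n ≤ numE d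
           × numE d ≤ (1ℚ + (+ 1 / 2) * Qof d) * ℕ→ℚ n
           × ℕ→ℚ (sumSq d) ≡ ((+ 4 / 1) + (+ 2 / 1) * Qof d) * numE d)
         × (ζ * (+ 1 / 4) ≤ Rof d
           × Rof d ≤ (+ 2 / 1) * ℕ→ℚ (maxDeg d))
lemma4 ζ 0<ζ ζ<1/10 n 0<n d _ n₀≡0 n₂≤[1-ζ]n ∣Q∣≤ζ/2 =
  (½n≤numE d n₀≡0 , numE≤[1+½Q]n d , sumSq≡[4+2Q]numE d) ,
  (¼ζ≤Rof ζ d (<⇒≤ 0<ζ) n₀≡0 n₂≤[1-ζ]n Q≤2 , Rof≤2Δ d Q≤1)
  where
  instance
    twoE≢0 : ℕ.NonZero (twoE d)
    twoE≢0 = ℕ.>-nonZero (ℕP.≤-trans 0<n (n≤twoE d n₀≡0))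
  Q≤1 : Qof d ≤ 1ℚ
  Q≤1 = begin
    Qof d                ≤⟨ p≤∣p∣ (Qof d) ⟩
    ∣ Qof d ∣            ≤⟨ ∣Q∣≤ζ/2 ⟩
    ζ * ½                ≤⟨ *-monoʳ-≤-nonNeg ½ (<⇒≤ ζ<1/10) ⟩
    (+ 1 / 10) * ½       ≤⟨ ℚ.*≤* (ℤ.+≤+ (ℕ.s≤s ℕ.z≤n)) ⟩
    1ℚ                   ∎
    where open ≤-Reasoning
  Q≤2 : Qof d ≤ ℕ→ℚ 2
  Q≤2 = ≤-trans Q≤1 (ℕ→ℚ-mono-≤ {1} {2} (ℕ.s≤s ℕ.z≤n))
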